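{- Let $l \geq 6$ be an integer and $\tau = \lfloor l/3 \rfloor$. For integers $0 \le j \le \tau$ define $$g_l(j) = \frac{(l+j)^{(2j)}\,(l+j)^{(2j)}}{(l+3j)^{(2j)}\,(l-j)^{(2j)}}, \qquad h_l(j) = \frac{l+j}{l-j},$$ (so $g_l(0)=h_l(0)=1$), and for a function $f$ on $\{0,\dots,\tau\}$ write $\Delta^2 f(j) = f(j+1) - 2f(j) + f(j-1)$ for $1 \le j \le \tau-1$ and $\Delta^3 f(j) = \Delta^2 f(j+1) - \Delta^2 f(j)$ for $1\le j\le \tau-2$. Then: (i) $h_l(j)$ is increasing in $j$ and $\Delta^2 h_l(j) > 0$ for $j = 1, \dots, \tau-1$; (ii) $\Delta^3 h_l(j) > 0$ for $j = 1, \dots, \tau-2$; (iii) $g_l(j)$ is increasing in $j$ and $\Delta^2 g_l(j) > 0$ for $j = 1, \dots, \tau-1$; (iv) $\Delta^3 g_l(j) > 0$ for $j = 1, \dots, \tau-2$; (v) $\Delta^2 g_l(1) > \Delta^2 h_l(\tau-1)$.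
   Context: For a real $x$ and integer $m \ge 0$, $x^{(m)} = x(x-1)\cdots(x-m+1)$ denotes the descending factorial power, with $x^{(0)}=1$. -}

module Defs where

open import Data.Nat as ℕ using (ℕ; zero; suc; _∸_; pred)
open import Data.Nat.DivMod using (_/_)
open import Data.Integer using (+_)
open import Data.Rational as ℚ using (ℚ; 0ℚ; _-_)

-- descending factorial power x^(m) = x (x-1) ... (x-m+1), x^(0) = 1.
-- For natural x this is exact (truncated subtraction only occurs after a
-- factor x - x = 0 has already appeared).
ff : ℕ → ℕ → ℕ
ff x zero    = 1
ff x (suc m) = ff x m ℕ.* (x ∸ m)

-- n / d as a rational; the d = 0 case is junk and never used on the
-- relevant range (all denominators are positive there).
frac : ℕ → ℕ → ℚ
frac n zero    = 0ℚ
frac n (suc d) = (+ n) ℚ./ suc d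

τ : ℕ → ℕ
τ l = l / 3

g : ℕ → ℕ → ℚ
g l j = frac (ff (l ℕ.+ j) (2 ℕ.* j) ℕ.* ff (l ℕ.+ j) (2 ℕ.* j))
             (ff (l ℕ.+ 3 ℕ.* j) (2 ℕ.* j) ℕ.* ff (l ∸ j) (2 ℕ.* j))

h : ℕ → ℕ → ℚ
h l j = frac (l ℕ.+ j) (l ∸ j)

-- Δ²f(j) = f(j+1) - 2 f(j) + f(j-1)   (used only for j ≥ 1)
Δ² : (ℕ → ℚ) → ℕ → ℚ
Δ² f j = (f (suc j) - ((+ 2) ℚ./ 1) ℚ.* f j) ℚ.+ f (pred j)

Δ³ : (ℕ → ℚ) → ℕ → ℚ
Δ³ f j = Δ² f (suc j) - Δ² f j

-- Put l = 3 (j + 1) + k. Both h l and g l satisfy f (j + 1) · Q(j,k) = f j · P(j,k) for polynomials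
-- P, Q with natural coefficients; for g the falling factorials telescope and P is the cube of the P of h.
-- Clearing denominators turns monotonicity, the positivity of Δ² and Δ³, and (v) (at l = 3 (c + 2) + s)
-- into strict inequalities between polynomials in two natural variables, and each of them already holds
-- coefficient by coefficient, which is checked by normalising both sides.
module Submission where

open import Data.Bool.Base using (Bool; true; _∧_; T)
open import Data.Bool.Properties using (T-∧)
open import Data.Integer.Base as ℤ using (+_)
import Data.Integer.Properties as ℤ
open import Data.List.Base using (List; []; _∷_)
open import Data.Nat.Base as ℕ using (ℕ; zero; suc; _≤_; _<_; _∸_; _≤ᵇ_; z≤n; s≤s)
open import Data.Nat.DivMod using (_%_; m≡m%n+[m/n]*n; m/n*n≤m; /-monoˡ-≤)
import Data.Nat.Properties as ℕ
open import Data.Nat.Tactic.RingSolver using (solve-∀)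
open import Data.Product.Base using (_×_; _,_; ∃-syntax)
open import Data.Rational.Base as ℚ using (ℚ; 0ℚ; _+_; _*_; _-_; toℚᵘ)
import Data.Rational.Properties as ℚ
open import Data.Rational.Solver using (module +-*-Solver)
open import Data.Rational.Unnormalised.Base as ℚᵘ using (mkℚᵘ; *≡*; *<*)
import Data.Rational.Unnormalised.Properties as ℚᵘ
open import Data.Unit.Base using (tt)
open import Function.Bundles using (Equivalence)
open import Relation.Binary.PropositionalEquality
open import Algebra.Properties.Group ℚ.+-0-group using (x≈y⇒x∙y⁻¹≈ε)

open import Defs

ι : ℕ → ℚ
ι n = + n ℚ./ 1

toℚᵘ-frac : ∀ n d → toℚᵘ (frac n (suc d)) ℚᵘ.≃ mkℚᵘ (+ n) d
toℚᵘ-frac n d = ℚ.toℚᵘ-fromℚᵘ (mkℚᵘ (+ n) d)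

module _ where
  open ℚᵘ.≃-Reasoning

  ι-+ : ∀ m n → ι (m ℕ.+ n) ≡ ι m + ι n
  ι-+ m n = ℚ.toℚᵘ-injective (begin
    toℚᵘ (ι (m ℕ.+ n))              ≈⟨ toℚᵘ-frac (m ℕ.+ n) 0 ⟩
    mkℚᵘ (+ (m ℕ.+ n)) 0            ≈⟨ ℚᵘ.≃-reflexive (cong (λ z → mkℚᵘ z 0) ↥-sum) ⟩
    mkℚᵘ (+ m) 0 ℚᵘ.+ mkℚᵘ (+ n) 0  ≈⟨ ℚᵘ.+-cong (toℚᵘ-frac m 0) (toℚᵘ-frac n 0) ⟨
    toℚᵘ (ι m) ℚᵘ.+ toℚᵘ (ι n)      ≈⟨ ℚ.toℚᵘ-homo-+ (ι m) (ι n) ⟨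
    toℚᵘ (ι m + ι n)                ∎)
    where
    ↥-sum : + (m ℕ.+ n) ≡ + m ℤ.* + 1 ℤ.+ + n ℤ.* + 1
    ↥-sum = trans (ℤ.pos-+ m n) (sym (cong₂ ℤ._+_ (ℤ.*-identityʳ (+ m)) (ℤ.*-identityʳ (+ n))))

  ι-* : ∀ m n → ι (m ℕ.* n) ≡ ι m * ι n
  ι-* m n = ℚ.toℚᵘ-injective (begin
    toℚᵘ (ι (m ℕ.* n))              ≈⟨ toℚᵘ-frac (m ℕ.* n) 0 ⟩
    mkℚᵘ (+ (m ℕ.* n)) 0            ≈⟨ ℚᵘ.≃-reflexive (cong (λ z → mkℚᵘ z 0) (ℤ.pos-* m n)) ⟩
    mkℚᵘ (+ m) 0 ℚᵘ.* mkℚᵘ (+ n) 0  ≈⟨ ℚᵘ.*-cong (toℚᵘ-frac m 0) (toℚᵘ-frac n 0) ⟨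
    toℚᵘ (ι m) ℚᵘ.* toℚᵘ (ι n)      ≈⟨ ℚ.toℚᵘ-homo-* (ι m) (ι n) ⟨
    toℚᵘ (ι m * ι n)                ∎)

  frac-*-ι : ∀ n {d} → 0 < d → frac n d * ι d ≡ ι n
  frac-*-ι n {suc d} _ = ℚ.toℚᵘ-injective (begin
    toℚᵘ (frac n (suc d) * ι (suc d))            ≈⟨ ℚ.toℚᵘ-homo-* (frac n (suc d)) (ι (suc d)) ⟩
    toℚᵘ (frac n (suc d)) ℚᵘ.* toℚᵘ (ι (suc d))  ≈⟨ ℚᵘ.*-cong (toℚᵘ-frac n d) (toℚᵘ-frac (suc d) 0) ⟩
    mkℚᵘ (+ n) d ℚᵘ.* mkℚᵘ (+ suc d) 0           ≈⟨ *≡* cross ⟩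
    mkℚᵘ (+ n) 0                                 ≈⟨ toℚᵘ-frac n 0 ⟨
    toℚᵘ (ι n)                                   ∎)
    where
    cross : (+ n ℤ.* + suc d) ℤ.* + 1 ≡ + n ℤ.* + suc (d ℕ.* 1)
    cross rewrite ℕ.*-identityʳ d = ℤ.*-identityʳ _

open ≡-Reasoning

ι-*³ : ∀ a b c → ι (a ℕ.* b ℕ.* c) ≡ ι a * ι b * ι c
ι-*³ a b c = trans (ι-* (a ℕ.* b) c) (cong (_* ι c) (ι-* a b))

ι-mono-< : ∀ {m n} → m < n → ι m ℚ.< ι n
ι-mono-< {m} {n} m<n = ℚ.toℚᵘ-cancel-<
  (ℚᵘ.<-respˡ-≃ (ℚᵘ.≃-sym (toℚᵘ-frac m 0)) (ℚᵘ.<-respʳ-≃ (ℚᵘ.≃-sym (toℚᵘ-frac n 0)) (*<* cross)))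
  where
  cross : + m ℤ.* + 1 ℤ.< + n ℤ.* + 1
  cross = subst₂ ℤ._<_ (sym (ℤ.*-identityʳ (+ m))) (sym (ℤ.*-identityʳ (+ n))) (ℤ.+<+ m<n)

*-pos : ∀ {a b} → 0ℚ ℚ.< a → 0ℚ ℚ.< b → 0ℚ ℚ.< a * b
*-pos {a} {b} 0<a 0<b = ℚ.positive⁻¹ _ {{ℚ.pos*pos⇒pos a {{ℚ.positive 0<a}} b {{ℚ.positive 0<b}}}}

*-cancelʳ-< : ∀ {a b c} → 0ℚ ℚ.< c → a * c ℚ.< b * c → a ℚ.< b
*-cancelʳ-< {c = c} 0<c = ℚ.*-cancelʳ-<-nonNeg c {{ℚ.pos⇒nonNeg c {{ℚ.positive 0<c}}}}

*-cancelʳ-≡ : ∀ {a b c} → 0ℚ ℚ.< c → a * c ≡ b * c → a ≡ b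
*-cancelʳ-≡ {c = c} 0<c ac≡bc = ℚ.≤-antisym
  (ℚ.*-cancelʳ-≤-pos c {{ℚ.positive 0<c}} (ℚ.≤-reflexive ac≡bc))
  (ℚ.*-cancelʳ-≤-pos c {{ℚ.positive 0<c}} (ℚ.≤-reflexive (sym ac≡bc)))

pos-cancelʳ : ∀ {a c} → 0ℚ ℚ.< c → 0ℚ ℚ.< a * c → 0ℚ ℚ.< a
pos-cancelʳ {a} {c} 0<c 0<ac = *-cancelʳ-< 0<c (subst (ℚ._< a * c) (sym (ℚ.*-zeroˡ c)) 0<ac)

frac-pos : ∀ {n d} → 0 < n → 0 < d → 0ℚ ℚ.< frac n d
frac-pos {n} 0<n 0<d = pos-cancelʳ (ι-mono-< 0<d) (subst (0ℚ ℚ.<_) (sym (frac-*-ι n 0<d)) (ι-mono-< 0<n))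

ι-diff-< : ∀ {a b c d} → a ℕ.+ d < c ℕ.+ b → ι a - ι b ℚ.< ι c - ι d
ι-diff-< {a} {b} {c} {d} a+d<c+b = subst₂ ℚ._<_ (cancel₁ (ι a) (ι d) (ι b)) (cancel₂ (ι c) (ι b) (ι d))
  (ℚ.+-monoˡ-< (ℚ.- (ι b + ι d)) (subst₂ ℚ._<_ (ι-+ a d) (ι-+ c b) (ι-mono-< a+d<c+b)))
  where
  open +-*-Solver
  cancel₁ : ∀ x y z → (x + y) - (z + y) ≡ x - z
  cancel₁ = solve 3 (λ x y z → (x :+ y) :- (z :+ y) := x :- z) refl
  cancel₂ : ∀ x y z → (x + y) - (y + z) ≡ x - z
  cancel₂ = solve 3 (λ x y z → (x :+ y) :- (y :+ z) := x :- z) refl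

ι-diff-pos : ∀ {a b} → b < a → 0ℚ ℚ.< ι a - ι b
ι-diff-pos {a} {b} b<a =
  subst (ℚ._< ι a - ι b) (ℚ.+-inverseʳ (ι b)) (ι-diff-< {b} {b} {a} {b} (ℕ.+-monoˡ-< b b<a))

ι-diff-* : ∀ a b d → (ι a - ι b) * ι d ≡ ι (a ℕ.* d) - ι (b ℕ.* d)
ι-diff-* a b d = begin
  (ι a - ι b) * ι d          ≡⟨ distrib (ι a) (ι b) (ι d) ⟩
  ι a * ι d - ι b * ι d      ≡⟨ cong₂ _-_ (ι-* a d) (ι-* b d) ⟨
  ι (a ℕ.* d) - ι (b ℕ.* d)  ∎
  where
  open +-*-Solver
  distrib : ∀ a b d → (a - b) * d ≡ a * d - b * d
  distrib = solve 3 (λ a b d → (a :- b) :* d := a :* d :- b :* d) refl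

ι-cross-diff : ∀ p a b q c d →
               ι p * (ι a - ι b) - ι q * (ι c - ι d) ≡ ι (p ℕ.* a ℕ.+ q ℕ.* d) - ι (p ℕ.* b ℕ.+ q ℕ.* c)
ι-cross-diff p a b q c d = begin
  ι p * (ι a - ι b) - ι q * (ι c - ι d)              ≡⟨ expand (ι p) (ι a) (ι b) (ι q) (ι c) (ι d) ⟩
  (ι p * ι a + ι q * ι d) - (ι p * ι b + ι q * ι c)  ≡⟨ cong₂ _-_ (ι-*+* p a q d) (ι-*+* p b q c) ⟨
  ι (p ℕ.* a ℕ.+ q ℕ.* d) - ι (p ℕ.* b ℕ.+ q ℕ.* c)  ∎
  where
  open +-*-Solver
  expand : ∀ p a b q c d → p * (a - b) - q * (c - d) ≡ (p * a + q * d) - (p * b + q * c)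
  expand = solve 6 (λ p a b q c d →
    p :* (a :- b) :- q :* (c :- d) := (p :* a :+ q :* d) :- (p :* b :+ q :* c)) refl
  ι-*+* : ∀ p a q d → ι (p ℕ.* a ℕ.+ q ℕ.* d) ≡ ι p * ι a + ι q * ι d
  ι-*+* p a q d = trans (ι-+ (p ℕ.* a) (q ℕ.* d)) (cong₂ _+_ (ι-* p a) (ι-* q d))

-- Cross-multiplication

<-by-ratio : ∀ {x y p q} → 0ℚ ℚ.< x → 0 < q → q < p → y * ι q ≡ x * ι p → x ℚ.< y
<-by-ratio {x} {y} {p} {q} 0<x 0<q q<p yq≡xp = *-cancelʳ-< (ι-mono-< 0<q)
  (subst (x * ι q ℚ.<_) (sym yq≡xp) (ℚ.*-monoʳ-<-pos x {{ℚ.positive 0<x}} (ι-mono-< q<p)))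

pos-by-cross : ∀ {X f a b d} → 0ℚ ℚ.< f → 0 < d → b < a → X * ι d ≡ f * (ι a - ι b) → 0ℚ ℚ.< X
pos-by-cross 0<f 0<d b<a eq =
  pos-cancelʳ (ι-mono-< 0<d) (subst (0ℚ ℚ.<_) (sym eq) (*-pos 0<f (ι-diff-pos b<a)))

<-by-cross : ∀ {X Y a b c e d₁ d₂} → 0 < d₁ → 0 < d₂ → X * ι d₁ ≡ ι a - ι b → Y * ι d₂ ≡ ι c - ι e →
             a ℕ.* d₂ ℕ.+ e ℕ.* d₁ < c ℕ.* d₁ ℕ.+ b ℕ.* d₂ → X ℚ.< Y
<-by-cross {X} {Y} {a} {b} {c} {e} {d₁} {d₂} 0<d₁ 0<d₂ EX EY ineq =
  *-cancelʳ-< (*-pos (ι-mono-< 0<d₁) (ι-mono-< 0<d₂))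
    (subst₂ ℚ._<_ (sym X-scaled) (sym Y-scaled) (ι-diff-< {a ℕ.* d₂} {b ℕ.* d₂} {c ℕ.* d₁} {e ℕ.* d₁} ineq))
  where
  X-scaled : X * (ι d₁ * ι d₂) ≡ ι (a ℕ.* d₂) - ι (b ℕ.* d₂)
  X-scaled = begin
    X * (ι d₁ * ι d₂)            ≡⟨ ℚ.*-assoc X (ι d₁) (ι d₂) ⟨
    X * ι d₁ * ι d₂              ≡⟨ cong (_* ι d₂) EX ⟩
    (ι a - ι b) * ι d₂           ≡⟨ ι-diff-* a b d₂ ⟩
    ι (a ℕ.* d₂) - ι (b ℕ.* d₂)  ∎
  Y-scaled : Y * (ι d₁ * ι d₂) ≡ ι (c ℕ.* d₁) - ι (e ℕ.* d₁)
  Y-scaled = begin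
    Y * (ι d₁ * ι d₂)            ≡⟨ cong (Y *_) (ℚ.*-comm (ι d₁) (ι d₂)) ⟩
    Y * (ι d₂ * ι d₁)            ≡⟨ ℚ.*-assoc Y (ι d₂) (ι d₁) ⟨
    Y * ι d₂ * ι d₁              ≡⟨ cong (_* ι d₁) EY ⟩
    (ι c - ι e) * ι d₁           ≡⟨ ι-diff-* c e d₁ ⟩
    ι (c ℕ.* d₁) - ι (e ℕ.* d₁)  ∎

ratio-by-cross : ∀ x y n₀ d₀ n₁ d₁ p q → 0 < d₀ → 0 < d₁ → x * ι d₀ ≡ ι n₀ → y * ι d₁ ≡ ι n₁ →
                 n₁ ℕ.* d₀ ℕ.* q ≡ n₀ ℕ.* d₁ ℕ.* p → y * ι q ≡ x * ι p
ratio-by-cross x y n₀ d₀ n₁ d₁ p q 0<d₀ 0<d₁ x≡ y≡ cross =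
  *-cancelʳ-≡ (*-pos (ι-mono-< 0<d₀) (ι-mono-< 0<d₁)) (begin
    y * ι q * (ι d₀ * ι d₁)  ≡⟨ swap₁ y (ι q) (ι d₀) (ι d₁) ⟩
    y * ι d₁ * ι d₀ * ι q    ≡⟨ cong (λ z → z * ι d₀ * ι q) y≡ ⟩
    ι n₁ * ι d₀ * ι q        ≡⟨ ι-*³ n₁ d₀ q ⟨
    ι (n₁ ℕ.* d₀ ℕ.* q)      ≡⟨ cong ι cross ⟩
    ι (n₀ ℕ.* d₁ ℕ.* p)      ≡⟨ ι-*³ n₀ d₁ p ⟩
    ι n₀ * ι d₁ * ι p        ≡⟨ cong (λ z → z * ι d₁ * ι p) x≡ ⟨
    x * ι d₀ * ι d₁ * ι p    ≡⟨ swap₂ x (ι p) (ι d₀) (ι d₁) ⟩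
    x * ι p * (ι d₀ * ι d₁)  ∎)
  where
  open +-*-Solver
  swap₁ : ∀ a b c d → a * b * (c * d) ≡ a * d * c * b
  swap₁ = solve 4 (λ a b c d → a :* b :* (c :* d) := a :* d :* c :* b) refl
  swap₂ : ∀ a b c d → a * c * d * b ≡ a * b * (c * d)
  swap₂ = solve 4 (λ a b c d → a :* c :* d :* b := a :* b :* (c :* d)) refl

rescale-cross : ∀ {X f a b d m n} → X * ι d ≡ f * (ι a - ι b) → f * ι m ≡ ι n →
                X * ι (d ℕ.* m) ≡ ι (a ℕ.* n) - ι (b ℕ.* n)
rescale-cross {X} {f} {a} {b} {d} {m} {n} E e = begin
  X * ι (d ℕ.* m)            ≡⟨ cong (X *_) (ι-* d m) ⟩
  X * (ι d * ι m)            ≡⟨ ℚ.*-assoc X (ι d) (ι m) ⟨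
  X * ι d * ι m              ≡⟨ cong (_* ι m) E ⟩
  f * (ι a - ι b) * ι m      ≡⟨ swap f (ι a - ι b) (ι m) ⟩
  f * ι m * (ι a - ι b)      ≡⟨ cong (_* (ι a - ι b)) e ⟩
  ι n * (ι a - ι b)          ≡⟨ ℚ.*-comm (ι n) (ι a - ι b) ⟩
  (ι a - ι b) * ι n          ≡⟨ ι-diff-* a b n ⟩
  ι (a ℕ.* n) - ι (b ℕ.* n)  ∎
  where
  open +-*-Solver
  swap : ∀ f α m → f * α * m ≡ f * m * α
  swap = solve 3 (λ f α m → f :* α :* m := f :* m :* α) refl

Δ²-cross : ∀ (f : ℕ → ℚ) i p₀ q₀ p₁ q₁ →
           f (suc i) * ι q₀ ≡ f i * ι p₀ → f (2 ℕ.+ i) * ι q₁ ≡ f (suc i) * ι p₁ →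
           Δ² f (suc i) * ι (q₀ ℕ.* q₁) ≡ f i * (ι (p₀ ℕ.* p₁ ℕ.+ q₀ ℕ.* q₁) - ι (2 ℕ.* p₀ ℕ.* q₁))
Δ²-cross f i p₀ q₀ p₁ q₁ e₀ e₁ = begin
  Δ² f (suc i) * ι (q₀ ℕ.* q₁)
    ≡⟨ cong (Δ² f (suc i) *_) (ι-* q₀ q₁) ⟩
  Δ² f (suc i) * (ι q₀ * ι q₁)
    ≡⟨ combination (f i) (f (suc i)) (f (2 ℕ.+ i)) (ι p₀) (ι q₀) (ι p₁) (ι q₁) ⟩
  r + (f (suc i) * ι q₀ - f i * ι p₀) * c₀ + (f (2 ℕ.+ i) * ι q₁ - f (suc i) * ι p₁) * ι q₀
    ≡⟨ cong₂ (λ u v → r + u * c₀ + v * ι q₀) (x≈y⇒x∙y⁻¹≈ε e₀) (x≈y⇒x∙y⁻¹≈ε e₁) ⟩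
  r + 0ℚ * c₀ + 0ℚ * ι q₀
    ≡⟨ drop-zeros r c₀ (ι q₀) ⟩
  r
    ≡⟨ cong (f i *_) (cong₂ _-_ ι-A ι-B) ⟨
  f i * (ι (p₀ ℕ.* p₁ ℕ.+ q₀ ℕ.* q₁) - ι (2 ℕ.* p₀ ℕ.* q₁))
    ∎
  where
  open +-*-Solver
  r c₀ : ℚ
  r  = f i * (ι p₀ * ι p₁ + ι q₀ * ι q₁ - ι 2 * ι p₀ * ι q₁)
  c₀ = ι p₁ - ι 2 * ι q₁
  combination : ∀ f₀ f₁ f₂ p₀ q₀ p₁ q₁ →
    ((f₂ - ι 2 * f₁) + f₀) * (q₀ * q₁)
      ≡ f₀ * (p₀ * p₁ + q₀ * q₁ - ι 2 * p₀ * q₁)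
        + (f₁ * q₀ - f₀ * p₀) * (p₁ - ι 2 * q₁) + (f₂ * q₁ - f₁ * p₁) * q₀
  combination = solve 7 (λ f₀ f₁ f₂ p₀ q₀ p₁ q₁ →
    ((f₂ :- con (ι 2) :* f₁) :+ f₀) :* (q₀ :* q₁)
      := f₀ :* (p₀ :* p₁ :+ q₀ :* q₁ :- con (ι 2) :* p₀ :* q₁)
         :+ (f₁ :* q₀ :- f₀ :* p₀) :* (p₁ :- con (ι 2) :* q₁) :+ (f₂ :* q₁ :- f₁ :* p₁) :* q₀) refl
  drop-zeros : ∀ r c d → r + 0ℚ * c + 0ℚ * d ≡ r
  drop-zeros = solve 3 (λ r c d → r :+ con 0ℚ :* c :+ con 0ℚ :* d := r) refl
  ι-A : ι (p₀ ℕ.* p₁ ℕ.+ q₀ ℕ.* q₁) ≡ ι p₀ * ι p₁ + ι q₀ * ι q₁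
  ι-A = trans (ι-+ (p₀ ℕ.* p₁) (q₀ ℕ.* q₁)) (cong₂ _+_ (ι-* p₀ p₁) (ι-* q₀ q₁))
  ι-B : ι (2 ℕ.* p₀ ℕ.* q₁) ≡ ι 2 * ι p₀ * ι q₁
  ι-B = ι-*³ 2 p₀ q₁

Δ³-cross : ∀ (f : ℕ → ℚ) i p₀ q₀ q₁ q₂ a₀ b₀ a₁ b₁ → f (suc i) * ι q₀ ≡ f i * ι p₀ →
           Δ² f (suc i) * ι (q₀ ℕ.* q₁) ≡ f i * (ι a₀ - ι b₀) →
           Δ² f (2 ℕ.+ i) * ι (q₁ ℕ.* q₂) ≡ f (suc i) * (ι a₁ - ι b₁) →
           Δ³ f (suc i) * ι (q₀ ℕ.* q₁ ℕ.* q₂)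
             ≡ f i * (ι (p₀ ℕ.* a₁ ℕ.+ q₂ ℕ.* b₀) - ι (p₀ ℕ.* b₁ ℕ.+ q₂ ℕ.* a₀))
Δ³-cross f i p₀ q₀ q₁ q₂ a₀ b₀ a₁ b₁ e₀ E₁ E₂ = begin
  (D₂ - D₁) * ι (q₀ ℕ.* q₁ ℕ.* q₂)
    ≡⟨ cong ((D₂ - D₁) *_) (ι-*³ q₀ q₁ q₂) ⟩
  (D₂ - D₁) * (ι q₀ * ι q₁ * ι q₂)
    ≡⟨ regroup D₁ D₂ (ι q₀) (ι q₁) (ι q₂) ⟩
  D₂ * (ι q₁ * ι q₂) * ι q₀ - D₁ * (ι q₀ * ι q₁) * ι q₂
    ≡⟨ cong₂ (λ u v → u * ι q₀ - v * ι q₂) (split D₂ q₁ q₂ E₂) (split D₁ q₀ q₁ E₁) ⟩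
  f (suc i) * α₁ * ι q₀ - f i * α₀ * ι q₂
    ≡⟨ swap (f (suc i)) α₁ (ι q₀) (f i * α₀ * ι q₂) ⟩
  f (suc i) * ι q₀ * α₁ - f i * α₀ * ι q₂
    ≡⟨ cong (λ u → u * α₁ - f i * α₀ * ι q₂) e₀ ⟩
  f i * ι p₀ * α₁ - f i * α₀ * ι q₂
    ≡⟨ factor (f i) (ι p₀) α₁ α₀ (ι q₂) ⟩
  f i * (ι p₀ * α₁ - ι q₂ * α₀)
    ≡⟨ cong (f i *_) (ι-cross-diff p₀ a₁ b₁ q₂ a₀ b₀) ⟩
  f i * (ι (p₀ ℕ.* a₁ ℕ.+ q₂ ℕ.* b₀) - ι (p₀ ℕ.* b₁ ℕ.+ q₂ ℕ.* a₀))
    ∎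
  where
  open +-*-Solver
  D₁ D₂ α₀ α₁ : ℚ
  D₁ = Δ² f (suc i)
  D₂ = Δ² f (2 ℕ.+ i)
  α₀ = ι a₀ - ι b₀
  α₁ = ι a₁ - ι b₁
  split : ∀ D q q′ {y} → D * ι (q ℕ.* q′) ≡ y → D * (ι q * ι q′) ≡ y
  split D q q′ = trans (cong (D *_) (sym (ι-* q q′)))
  regroup : ∀ D₁ D₂ q₀ q₁ q₂ →
    (D₂ - D₁) * (q₀ * q₁ * q₂) ≡ D₂ * (q₁ * q₂) * q₀ - D₁ * (q₀ * q₁) * q₂
  regroup = solve 5 (λ D₁ D₂ q₀ q₁ q₂ →
    (D₂ :- D₁) :* (q₀ :* q₁ :* q₂) := D₂ :* (q₁ :* q₂) :* q₀ :- D₁ :* (q₀ :* q₁) :* q₂) refl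
  swap : ∀ f α q r → f * α * q - r ≡ f * q * α - r
  swap = solve 4 (λ f α q r → f :* α :* q :- r := f :* q :* α :- r) refl
  factor : ∀ f p α β q → f * p * α - f * β * q ≡ f * (p * α - q * β)
  factor = solve 5 (λ f p α β q → f :* p :* α :- f :* β :* q := f :* (p :* α :- q :* β)) refl

-- Polynomials in two variables, compared coefficientwise

infixl 6 _⊕_
infixl 7 _⊗_

data Expr : Set where
  X Y     : Expr
  con     : ℕ → Expr
  _⊕_ _⊗_ : Expr → Expr → Expr

⟦_⟧ : Expr → ℕ → ℕ → ℕ
⟦ X ⟧       x y = x
⟦ Y ⟧       x y = y
⟦ con n ⟧   x y = n
⟦ e ⊕ e′ ⟧ x y = ⟦ e ⟧ x y ℕ.+ ⟦ e′ ⟧ x y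
⟦ e ⊗ e′ ⟧ x y = ⟦ e ⟧ x y ℕ.* ⟦ e′ ⟧ x y

-- Polynomials in one variable over a coefficient type C, as lists of coefficients, constant first.
module Horner {C : Set} (0# : C) (_+ᶜ_ _*ᶜ_ : C → C → C) (_≤ᶜ_ : C → C → Bool) where

  _⊞_ : List C → List C → List C
  []      ⊞ q       = q
  (a ∷ p) ⊞ []      = a ∷ p
  (a ∷ p) ⊞ (b ∷ q) = (a +ᶜ b) ∷ (p ⊞ q)

  _⊛_ : C → List C → List C
  a ⊛ []      = []
  a ⊛ (b ∷ q) = (a *ᶜ b) ∷ (a ⊛ q)

  _⊠_ : List C → List C → List C
  []      ⊠ q = []
  (a ∷ p) ⊠ q = (a ⊛ q) ⊞ (0# ∷ (p ⊠ q))

  _≤ᴴ_ : List C → List C → Bool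
  []      ≤ᴴ _       = true
  (a ∷ p) ≤ᴴ []      = (a ≤ᶜ 0#) ∧ (p ≤ᴴ [])
  (a ∷ p) ≤ᴴ (b ∷ q) = (a ≤ᶜ b) ∧ (p ≤ᴴ q)

  module Sound (⟦_⟧ᶜ : C → ℕ) (⟦0#⟧ : ⟦ 0# ⟧ᶜ ≡ 0)
               (⟦+⟧ : ∀ a b → ⟦ a +ᶜ b ⟧ᶜ ≡ ⟦ a ⟧ᶜ ℕ.+ ⟦ b ⟧ᶜ)
               (⟦*⟧ : ∀ a b → ⟦ a *ᶜ b ⟧ᶜ ≡ ⟦ a ⟧ᶜ ℕ.* ⟦ b ⟧ᶜ)
               (≤ᶜ-sound : ∀ a b → T (a ≤ᶜ b) → ⟦ a ⟧ᶜ ≤ ⟦ b ⟧ᶜ)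
               (t : ℕ) where

    eval : List C → ℕ
    eval []      = 0
    eval (a ∷ p) = ⟦ a ⟧ᶜ ℕ.+ t ℕ.* eval p

    eval-⊞ : ∀ p q → eval (p ⊞ q) ≡ eval p ℕ.+ eval q
    eval-⊞ []      q       = refl
    eval-⊞ (a ∷ p) []      = sym (ℕ.+-identityʳ _)
    eval-⊞ (a ∷ p) (b ∷ q) rewrite ⟦+⟧ a b | eval-⊞ p q =
      interchange ⟦ a ⟧ᶜ ⟦ b ⟧ᶜ t (eval p) (eval q)
      where
      interchange : ∀ a b t p q → a ℕ.+ b ℕ.+ t ℕ.* (p ℕ.+ q) ≡ a ℕ.+ t ℕ.* p ℕ.+ (b ℕ.+ t ℕ.* q)
      interchange = solve-∀

    eval-⊛ : ∀ a q → eval (a ⊛ q) ≡ ⟦ a ⟧ᶜ ℕ.* eval q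
    eval-⊛ a []      = sym (ℕ.*-zeroʳ ⟦ a ⟧ᶜ)
    eval-⊛ a (b ∷ q) rewrite ⟦*⟧ a b | eval-⊛ a q =
      distrib ⟦ a ⟧ᶜ ⟦ b ⟧ᶜ t (eval q)
      where
      distrib : ∀ a b t q → a ℕ.* b ℕ.+ t ℕ.* (a ℕ.* q) ≡ a ℕ.* (b ℕ.+ t ℕ.* q)
      distrib = solve-∀

    eval-⊠ : ∀ p q → eval (p ⊠ q) ≡ eval p ℕ.* eval q
    eval-⊠ []      q = refl
    eval-⊠ (a ∷ p) q = begin
      eval ((a ⊛ q) ⊞ (0# ∷ (p ⊠ q)))
        ≡⟨ eval-⊞ (a ⊛ q) (0# ∷ (p ⊠ q)) ⟩
      eval (a ⊛ q) ℕ.+ (⟦ 0# ⟧ᶜ ℕ.+ t ℕ.* eval (p ⊠ q))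
        ≡⟨ cong₂ (λ u v → u ℕ.+ (v ℕ.+ t ℕ.* eval (p ⊠ q))) (eval-⊛ a q) ⟦0#⟧ ⟩
      ⟦ a ⟧ᶜ ℕ.* eval q ℕ.+ t ℕ.* eval (p ⊠ q)
        ≡⟨ cong (λ u → ⟦ a ⟧ᶜ ℕ.* eval q ℕ.+ t ℕ.* u) (eval-⊠ p q) ⟩
      ⟦ a ⟧ᶜ ℕ.* eval q ℕ.+ t ℕ.* (eval p ℕ.* eval q)
        ≡⟨ distrib ⟦ a ⟧ᶜ (eval q) t (eval p) ⟩
      (⟦ a ⟧ᶜ ℕ.+ t ℕ.* eval p) ℕ.* eval q
        ∎
      where
      distrib : ∀ a q t p → a ℕ.* q ℕ.+ t ℕ.* (p ℕ.* q) ≡ (a ℕ.+ t ℕ.* p) ℕ.* q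
      distrib = solve-∀

    ≤ᴴ-sound : ∀ p q → T (p ≤ᴴ q) → eval p ≤ eval q
    ≤ᴴ-sound []      q       _ = z≤n
    ≤ᴴ-sound (a ∷ p) []      h with a≤0 , p≤[] ← Equivalence.to T-∧ h =
      subst (⟦ a ⟧ᶜ ℕ.+ t ℕ.* eval p ≤_) (cong₂ ℕ._+_ ⟦0#⟧ (ℕ.*-zeroʳ t))
        (ℕ.+-mono-≤ (≤ᶜ-sound a 0# a≤0) (ℕ.*-monoʳ-≤ t (≤ᴴ-sound p [] p≤[])))
    ≤ᴴ-sound (a ∷ p) (b ∷ q) h with a≤b , p≤q ← Equivalence.to T-∧ h =
      ℕ.+-mono-≤ (≤ᶜ-sound a b a≤b) (ℕ.*-monoʳ-≤ t (≤ᴴ-sound p q p≤q))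

-- A polynomial in X and Y is a polynomial in X whose coefficients are polynomials in Y.
module Horner₁ = Horner 0 ℕ._+_ ℕ._*_ _≤ᵇ_
module Horner₂ = Horner [] Horner₁._⊞_ Horner₁._⊠_ Horner₁._≤ᴴ_

module Sound₁ (y : ℕ) = Horner₁.Sound (λ c → c) refl (λ _ _ → refl) (λ _ _ → refl) ℕ.≤ᵇ⇒≤ y
module Sound₂ (x y : ℕ) =
  Horner₂.Sound (Sound₁.eval y) refl (Sound₁.eval-⊞ y) (Sound₁.eval-⊠ y) (Sound₁.≤ᴴ-sound y) x

normalize : Expr → List (List ℕ)
normalize X        = [] ∷ (1 ∷ []) ∷ []
normalize Y        = (0 ∷ 1 ∷ []) ∷ []
normalize (con n)  = (n ∷ []) ∷ []
normalize (e ⊕ e′) = normalize e Horner₂.⊞ normalize e′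
normalize (e ⊗ e′) = normalize e Horner₂.⊠ normalize e′

normalize-sound : ∀ e x y → Sound₂.eval x y (normalize e) ≡ ⟦ e ⟧ x y
normalize-sound X        x y = eval-X x y
  where
  eval-X : ∀ x y → 0 ℕ.+ x ℕ.* ((1 ℕ.+ y ℕ.* 0) ℕ.+ x ℕ.* 0) ≡ x
  eval-X = solve-∀
normalize-sound Y        x y = eval-Y x y
  where
  eval-Y : ∀ x y → (0 ℕ.+ y ℕ.* (1 ℕ.+ y ℕ.* 0)) ℕ.+ x ℕ.* 0 ≡ y
  eval-Y = solve-∀
normalize-sound (con n)  x y = eval-con n x y
  where
  eval-con : ∀ n x y → (n ℕ.+ y ℕ.* 0) ℕ.+ x ℕ.* 0 ≡ n
  eval-con = solve-∀
normalize-sound (e ⊕ e′) x y = trans (Sound₂.eval-⊞ x y (normalize e) (normalize e′))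
                                     (cong₂ ℕ._+_ (normalize-sound e x y) (normalize-sound e′ x y))
normalize-sound (e ⊗ e′) x y = trans (Sound₂.eval-⊠ x y (normalize e) (normalize e′))
                                     (cong₂ ℕ._*_ (normalize-sound e x y) (normalize-sound e′ x y))

_≺_ : Expr → Expr → Bool
e ≺ e′ = normalize (e ⊕ con 1) Horner₂.≤ᴴ normalize e′

≺⇒< : ∀ e e′ → T (e ≺ e′) → ∀ x y → ⟦ e ⟧ x y < ⟦ e′ ⟧ x y
≺⇒< e e′ e≺e′ x y =
  subst₂ _≤_ (trans (normalize-sound (e ⊕ con 1) x y) (ℕ.+-comm (⟦ e ⟧ x y) 1)) (normalize-sound e′ x y)
    (Sound₂.≤ᴴ-sound x y (normalize (e ⊕ con 1)) (normalize e′) e≺e′)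

-- Sequences with a polynomial ratio

-- The numerators of Δ² and Δ³ after clearing denominators, written once over any carrier so that
-- they can be read both as numbers and as polynomial expressions. The indices i, b stand for
-- the point l = 3 (i + 2) + b.
module Numerators {A : Set} (_+ᵃ_ _*ᵃ_ : A → A → A) (κ : ℕ → A) where

  Δ²⁺ Δ²⁻ Δ²-den Δ³⁺ Δ³⁻ Δ³-den : (P Q : A → A → A) → A → A → A
  Δ²⁺ P Q i b    = (P i (κ 3 +ᵃ b) *ᵃ P (κ 1 +ᵃ i) b) +ᵃ (Q i (κ 3 +ᵃ b) *ᵃ Q (κ 1 +ᵃ i) b)
  Δ²⁻ P Q i b    = (κ 2 *ᵃ P i (κ 3 +ᵃ b)) *ᵃ Q (κ 1 +ᵃ i) b
  Δ²-den P Q i b = Q i (κ 3 +ᵃ b) *ᵃ Q (κ 1 +ᵃ i) b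
  Δ³⁺ P Q i b    = (P i (κ 3 +ᵃ (κ 3 +ᵃ b)) *ᵃ Δ²⁺ P Q (κ 1 +ᵃ i) b)
                   +ᵃ (Q (κ 1 +ᵃ (κ 1 +ᵃ i)) b *ᵃ Δ²⁻ P Q i (κ 3 +ᵃ b))
  Δ³⁻ P Q i b    = (P i (κ 3 +ᵃ (κ 3 +ᵃ b)) *ᵃ Δ²⁻ P Q (κ 1 +ᵃ i) b)
                   +ᵃ (Q (κ 1 +ᵃ (κ 1 +ᵃ i)) b *ᵃ Δ²⁺ P Q i (κ 3 +ᵃ b))
  Δ³-den P Q i b = Δ²-den P Q i (κ 3 +ᵃ b) *ᵃ Q (κ 1 +ᵃ (κ 1 +ᵃ i)) b

  -- Cleared form of (v) at l = 3 (c + 2) + s, where h l c = (6 + 4c + s) / (6 + 2c + s) and g l 0 = 1.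
  comparison⁻ comparison⁺ : (Pʰ Qʰ Pᵍ Qᵍ : A → A → A) → A → A → A
  comparison⁻ Pʰ Qʰ Pᵍ Qᵍ c s =
    ((Δ²⁺ Pʰ Qʰ c s *ᵃ ((κ 6 +ᵃ (κ 4 *ᵃ c)) +ᵃ s)) *ᵃ Δ²-den Pᵍ Qᵍ (κ 0) ((κ 3 *ᵃ c) +ᵃ s))
    +ᵃ (Δ²⁻ Pᵍ Qᵍ (κ 0) ((κ 3 *ᵃ c) +ᵃ s) *ᵃ (Δ²-den Pʰ Qʰ c s *ᵃ ((κ 6 +ᵃ (κ 2 *ᵃ c)) +ᵃ s)))
  comparison⁺ Pʰ Qʰ Pᵍ Qᵍ c s =
    (Δ²⁺ Pᵍ Qᵍ (κ 0) ((κ 3 *ᵃ c) +ᵃ s) *ᵃ (Δ²-den Pʰ Qʰ c s *ᵃ ((κ 6 +ᵃ (κ 2 *ᵃ c)) +ᵃ s)))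
    +ᵃ ((Δ²⁻ Pʰ Qʰ c s *ᵃ ((κ 6 +ᵃ (κ 4 *ᵃ c)) +ᵃ s)) *ᵃ Δ²-den Pᵍ Qᵍ (κ 0) ((κ 3 *ᵃ c) +ᵃ s))

open Numerators ℕ._+_ ℕ._*_ (λ n → n)
module Numeratorsᴱ = Numerators _⊕_ _⊗_ con

*-posᴺ : ∀ {m n} → 0 < m → 0 < n → 0 < m ℕ.* n
*-posᴺ {suc m} {suc n} _ _ = s≤s z≤n

τ-bound : ∀ {m} l → m ≤ τ l → 3 ℕ.* m ≤ l
τ-bound {m} l m≤τ = ℕ.≤-trans (ℕ.*-monoʳ-≤ 3 m≤τ) (subst (_≤ l) (ℕ.*-comm (τ l) 3) (m/n*n≤m l 3))

τ-slack : ∀ {l} n j → j ℕ.+ n ≤ τ l → ∃[ k ] 3 ℕ.* (n ℕ.+ j) ℕ.+ k ≡ l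
τ-slack {l} n j j+n≤τ = ℕ.m≤n⇒∃[o]m+o≡n (τ-bound l (subst (_≤ τ l) (ℕ.+-comm j n) j+n≤τ))

slack-shift : ∀ {l} j k → 3 ℕ.* suc (suc j) ℕ.+ k ≡ l → 3 ℕ.* suc j ℕ.+ (3 ℕ.+ k) ≡ l
slack-shift j k = trans (shift j k)
  where
  shift : ∀ j k → 3 ℕ.* suc j ℕ.+ (3 ℕ.+ k) ≡ 3 ℕ.* suc (suc j) ℕ.+ k
  shift = solve-∀

record RatioSequence : Set where
  field
    F       : ℕ → ℕ → ℚ
    P Q     : ℕ → ℕ → ℕ
    F-pos₀  : ∀ {l} → 0 < l → 0ℚ ℚ.< F l 0
    step    : ∀ {l} j k → 3 ℕ.* suc j ℕ.+ k ≡ l → F l (suc j) * ι (Q j k) ≡ F l j * ι (P j k)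
    Q-pos   : ∀ j k → 0 < Q j k
    Q<P     : ∀ j k → Q j k < P j k
    Δ²⁻<Δ²⁺ : ∀ i b → Δ²⁻ P Q i b < Δ²⁺ P Q i b
    Δ³⁻<Δ³⁺ : ∀ i b → Δ³⁻ P Q i b < Δ³⁺ P Q i b

module RatioSequenceProperties (S : RatioSequence) where
  open RatioSequence S

  step-< : ∀ {l} j k → 3 ℕ.* suc j ℕ.+ k ≡ l → 0ℚ ℚ.< F l j → F l j ℚ.< F l (suc j)
  step-< j k eq 0<F = <-by-ratio 0<F (Q-pos j k) (Q<P j k) (step j k eq)

  F-pos : ∀ {l} j k → 3 ℕ.* suc j ℕ.+ k ≡ l → 0ℚ ℚ.< F l j
  F-pos zero    k refl = F-pos₀ (s≤s z≤n)
  F-pos (suc j) k eq   = ℚ.<-trans 0<F (step-< j (3 ℕ.+ k) (slack-shift j k eq) 0<F)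
    where
    0<F : 0ℚ ℚ.< F _ j
    0<F = F-pos j (3 ℕ.+ k) (slack-shift j k eq)

  increasing : ∀ l j → j < τ l → F l j ℚ.< F l (suc j)
  increasing l j j<τ with k , eq ← ℕ.m≤n⇒∃[o]m+o≡n (τ-bound l j<τ) = step-< j k eq (F-pos j k eq)

  Δ²-identity : ∀ {l} i b → 3 ℕ.* suc (suc i) ℕ.+ b ≡ l →
                Δ² (F l) (suc i) * ι (Δ²-den P Q i b) ≡ F l i * (ι (Δ²⁺ P Q i b) - ι (Δ²⁻ P Q i b))
  Δ²-identity {l} i b eq = Δ²-cross (F l) i (P i (3 ℕ.+ b)) (Q i (3 ℕ.+ b)) (P (suc i) b) (Q (suc i) b)
    (step i (3 ℕ.+ b) (slack-shift i b eq)) (step (suc i) b eq)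

  Δ³-identity : ∀ {l} i b → 3 ℕ.* suc (suc (suc i)) ℕ.+ b ≡ l →
                Δ³ (F l) (suc i) * ι (Δ³-den P Q i b) ≡ F l i * (ι (Δ³⁺ P Q i b) - ι (Δ³⁻ P Q i b))
  Δ³-identity {l} i b eq =
    Δ³-cross (F l) i (P i (6 ℕ.+ b)) (Q i (6 ℕ.+ b)) (Q (suc i) (3 ℕ.+ b)) (Q (suc (suc i)) b)
    (Δ²⁺ P Q i (3 ℕ.+ b)) (Δ²⁻ P Q i (3 ℕ.+ b)) (Δ²⁺ P Q (suc i) b) (Δ²⁻ P Q (suc i) b)
    (step i (6 ℕ.+ b) (slack-shift i (3 ℕ.+ b) eq′)) (Δ²-identity i (3 ℕ.+ b) eq′) (Δ²-identity (suc i) b eq)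
    where
    eq′ : 3 ℕ.* suc (suc i) ℕ.+ (3 ℕ.+ b) ≡ l
    eq′ = slack-shift (suc i) b eq

  Δ²-pos : ∀ l j → 1 ≤ j → j ℕ.+ 1 ≤ τ l → 0ℚ ℚ.< Δ² (F l) j
  Δ²-pos l (suc i) _ j+1≤τ with b , eq ← τ-slack 1 (suc i) j+1≤τ =
    pos-by-cross (F-pos i (3 ℕ.+ b) (slack-shift i b eq)) (*-posᴺ (Q-pos i (3 ℕ.+ b)) (Q-pos (suc i) b))
      (Δ²⁻<Δ²⁺ i b) (Δ²-identity i b eq)

  Δ³-pos : ∀ l j → 1 ≤ j → j ℕ.+ 2 ≤ τ l → 0ℚ ℚ.< Δ³ (F l) j
  Δ³-pos l (suc i) _ j+2≤τ with b , eq ← τ-slack 2 (suc i) j+2≤τ =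
    pos-by-cross (F-pos i (6 ℕ.+ b) (slack-shift i (3 ℕ.+ b) (slack-shift (suc i) b eq)))
      (*-posᴺ (*-posᴺ (Q-pos i (6 ℕ.+ b)) (Q-pos (suc i) (3 ℕ.+ b))) (Q-pos (suc (suc i)) b))
      (Δ³⁻<Δ³⁺ i b) (Δ³-identity i b eq)

⟪_⟫ : (Expr → Expr → Expr) → ℕ → ℕ → ℕ
⟪ P ⟫ j k = ⟦ P X Y ⟧ j k

Pʰ Qʰ : Expr → Expr → Expr
Pʰ j k = (con 4 ⊕ con 4 ⊗ j ⊕ k) ⊗ (con 3 ⊕ con 2 ⊗ j ⊕ k)
Qʰ j k = (con 3 ⊕ con 4 ⊗ j ⊕ k) ⊗ (con 2 ⊕ con 2 ⊗ j ⊕ k)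

h-*-ι : ∀ {l} j d → j ℕ.+ d ≡ l → 0 < d → h l j * ι d ≡ ι (l ℕ.+ j)
h-*-ι j d refl 0<d rewrite ℕ.m+n∸m≡n j d = frac-*-ι (j ℕ.+ d ℕ.+ j) 0<d

h-step : ∀ {l} j k → 3 ℕ.* suc j ℕ.+ k ≡ l → h l (suc j) * ι (⟪ Qʰ ⟫ j k) ≡ h l j * ι (⟪ Pʰ ⟫ j k)
h-step {l} j k refl =
  ratio-by-cross (h l j) (h l (suc j)) (l ℕ.+ j) (3 ℕ.+ 2 ℕ.* j ℕ.+ k) (l ℕ.+ suc j) (2 ℕ.+ 2 ℕ.* j ℕ.+ k)
    (⟪ Pʰ ⟫ j k) (⟪ Qʰ ⟫ j k) (s≤s z≤n) (s≤s z≤n)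
    (h-*-ι j (3 ℕ.+ 2 ℕ.* j ℕ.+ k) (split₀ j k) (s≤s z≤n))
    (h-*-ι (suc j) (2 ℕ.+ 2 ℕ.* j ℕ.+ k) (split₁ j k) (s≤s z≤n))
    (cross j k)
  where
  split₀ : ∀ j k → j ℕ.+ (3 ℕ.+ 2 ℕ.* j ℕ.+ k) ≡ 3 ℕ.* suc j ℕ.+ k
  split₀ = solve-∀
  split₁ : ∀ j k → suc j ℕ.+ (2 ℕ.+ 2 ℕ.* j ℕ.+ k) ≡ 3 ℕ.* suc j ℕ.+ k
  split₁ = solve-∀
  cross : ∀ j k →
    (3 ℕ.* suc j ℕ.+ k ℕ.+ suc j) ℕ.* (3 ℕ.+ 2 ℕ.* j ℕ.+ k) ℕ.* ((3 ℕ.+ 4 ℕ.* j ℕ.+ k) ℕ.* (2 ℕ.+ 2 ℕ.* j ℕ.+ k))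
      ≡ (3 ℕ.* suc j ℕ.+ k ℕ.+ j) ℕ.* (2 ℕ.+ 2 ℕ.* j ℕ.+ k) ℕ.* ((4 ℕ.+ 4 ℕ.* j ℕ.+ k) ℕ.* (3 ℕ.+ 2 ℕ.* j ℕ.+ k))
  cross = solve-∀

h-sequence : RatioSequence
h-sequence = record
  { F       = h
  ; P       = ⟪ Pʰ ⟫
  ; Q       = ⟪ Qʰ ⟫
  ; F-pos₀  = λ {l} 0<l → frac-pos (ℕ.≤-trans 0<l (ℕ.m≤m+n l 0)) 0<l
  ; step    = h-step
  ; Q-pos   = ≺⇒< (con 0) (Qʰ X Y) tt
  ; Q<P     = ≺⇒< (Qʰ X Y) (Pʰ X Y) tt
  ; Δ²⁻<Δ²⁺ = ≺⇒< (Numeratorsᴱ.Δ²⁻ Pʰ Qʰ X Y) (Numeratorsᴱ.Δ²⁺ Pʰ Qʰ X Y) tt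
  ; Δ³⁻<Δ³⁺ = ≺⇒< (Numeratorsᴱ.Δ³⁻ Pʰ Qʰ X Y) (Numeratorsᴱ.Δ³⁺ Pʰ Qʰ X Y) tt
  }

module H = RatioSequenceProperties h-sequence

ff-+ : ∀ x m n → ff x (m ℕ.+ n) ≡ ff x m ℕ.* ff (x ∸ m) n
ff-+ x m zero    = trans (cong (ff x) (ℕ.+-identityʳ m)) (sym (ℕ.*-identityʳ (ff x m)))
ff-+ x m (suc n) = begin
  ff x (m ℕ.+ suc n)                       ≡⟨ cong (ff x) (ℕ.+-suc m n) ⟩
  ff x (m ℕ.+ n) ℕ.* (x ∸ (m ℕ.+ n))       ≡⟨ cong₂ ℕ._*_ (ff-+ x m n) (sym (ℕ.∸-+-assoc x m n)) ⟩
  ff x m ℕ.* ff (x ∸ m) n ℕ.* (x ∸ m ∸ n)  ≡⟨ ℕ.*-assoc (ff x m) (ff (x ∸ m) n) (x ∸ m ∸ n) ⟩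
  ff x m ℕ.* ff (x ∸ m) (suc n)            ∎

ff-suc : ∀ x m → ff (suc x) (suc m) ≡ suc x ℕ.* ff x m
ff-suc x m = trans (ff-+ (suc x) 1 m) (cong (ℕ._* ff x m) (ℕ.*-identityˡ (suc x)))

ff-pos : ∀ {x m} → m ≤ x → 0 < ff x m
ff-pos {m = zero}  _   = s≤s z≤n
ff-pos {m = suc m} m<x = *-posᴺ (ff-pos (ℕ.<⇒≤ m<x)) (ℕ.m<n⇒0<n∸m m<x)

m+n≡o⇒o∸m≡n : ∀ {o} m n → m ℕ.+ n ≡ o → o ∸ m ≡ n
m+n≡o⇒o∸m≡n m n refl = ℕ.m+n∸m≡n m n

ff-l+j-step : ∀ m y → ff (suc (m ℕ.+ y)) (2 ℕ.+ m) ≡ suc (m ℕ.+ y) ℕ.* ff (m ℕ.+ y) m ℕ.* y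
ff-l+j-step m y = cong₂ ℕ._*_ (ff-suc (m ℕ.+ y) m) (ℕ.m+n∸m≡n m y)

ff-l+3j-step : ∀ m z → ff (3 ℕ.+ (m ℕ.+ z)) (2 ℕ.+ m) ℕ.* suc z ≡ ff (3 ℕ.+ (m ℕ.+ z)) 3 ℕ.* ff (m ℕ.+ z) m
ff-l+3j-step m z =
  trans (cong (ff (3 ℕ.+ (m ℕ.+ z)) (2 ℕ.+ m) ℕ.*_) (sym (m+n≡o⇒o∸m≡n m (suc z) (ℕ.+-suc m z))))
        (ff-+ (3 ℕ.+ (m ℕ.+ z)) 3 m)

ff-l∸j-step : ∀ m k →
              ff (2 ℕ.+ m ℕ.+ k) (2 ℕ.+ m) ℕ.* (3 ℕ.+ m ℕ.+ k) ≡ ff (3 ℕ.+ m ℕ.+ k) m ℕ.* ff (3 ℕ.+ k) 3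
ff-l∸j-step m k = begin
  ff (2 ℕ.+ m ℕ.+ k) (2 ℕ.+ m) ℕ.* (3 ℕ.+ m ℕ.+ k)  ≡⟨ ℕ.*-comm (ff (2 ℕ.+ m ℕ.+ k) (2 ℕ.+ m)) _ ⟩
  (3 ℕ.+ m ℕ.+ k) ℕ.* ff (2 ℕ.+ m ℕ.+ k) (2 ℕ.+ m)  ≡⟨ ff-suc (2 ℕ.+ m ℕ.+ k) (2 ℕ.+ m) ⟨
  ff (3 ℕ.+ m ℕ.+ k) (3 ℕ.+ m)                       ≡⟨ cong (ff (3 ℕ.+ m ℕ.+ k)) (ℕ.+-comm 3 m) ⟩
  ff (3 ℕ.+ m ℕ.+ k) (m ℕ.+ 3)                       ≡⟨ ff-+ (3 ℕ.+ m ℕ.+ k) m 3 ⟩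
  ff (3 ℕ.+ m ℕ.+ k) m ℕ.* ff (3 ℕ.+ m ℕ.+ k ∸ m) 3  ≡⟨ cong (λ t → ff (3 ℕ.+ m ℕ.+ k) m ℕ.* ff t 3)
                                                           (m+n≡o⇒o∸m≡n m (3 ℕ.+ k) (shuffle m k)) ⟩
  ff (3 ℕ.+ m ℕ.+ k) m ℕ.* ff (3 ℕ.+ k) 3            ∎
  where
  shuffle : ∀ m k → m ℕ.+ (3 ℕ.+ k) ≡ 3 ℕ.+ m ℕ.+ k
  shuffle = solve-∀

g-ratio-cross : ∀ A B C A′ B′ C′ x y x′ y′ R S →
                A′ ≡ x ℕ.* A ℕ.* y → B′ ℕ.* x′ ≡ R ℕ.* B → C′ ℕ.* y′ ≡ C ℕ.* S →
                A′ ℕ.* A′ ℕ.* (B ℕ.* C) ℕ.* (S ℕ.* R)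
                  ≡ A ℕ.* A ℕ.* (B′ ℕ.* C′) ℕ.* (x ℕ.* y ℕ.* (x ℕ.* y) ℕ.* (x′ ℕ.* y′))
g-ratio-cross A B C _ B′ C′ x y x′ y′ R S refl eB eC = begin
  x ℕ.* A ℕ.* y ℕ.* (x ℕ.* A ℕ.* y) ℕ.* (B ℕ.* C) ℕ.* (S ℕ.* R)
    ≡⟨ regroup₁ A B C x y R S ⟩
  A ℕ.* A ℕ.* xyxy ℕ.* (R ℕ.* B ℕ.* (C ℕ.* S))
    ≡⟨ cong (A ℕ.* A ℕ.* xyxy ℕ.*_) (cong₂ ℕ._*_ eB eC) ⟨
  A ℕ.* A ℕ.* xyxy ℕ.* (B′ ℕ.* x′ ℕ.* (C′ ℕ.* y′))
    ≡⟨ regroup₂ A B′ C′ xyxy x′ y′ ⟩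
  A ℕ.* A ℕ.* (B′ ℕ.* C′) ℕ.* (xyxy ℕ.* (x′ ℕ.* y′))
    ∎
  where
  xyxy : ℕ
  xyxy = x ℕ.* y ℕ.* (x ℕ.* y)
  regroup₁ : ∀ A B C x y R S → x ℕ.* A ℕ.* y ℕ.* (x ℕ.* A ℕ.* y) ℕ.* (B ℕ.* C) ℕ.* (S ℕ.* R)
                                 ≡ A ℕ.* A ℕ.* (x ℕ.* y ℕ.* (x ℕ.* y)) ℕ.* (R ℕ.* B ℕ.* (C ℕ.* S))
  regroup₁ = solve-∀
  regroup₂ : ∀ A B′ C′ w x′ y′ → A ℕ.* A ℕ.* w ℕ.* (B′ ℕ.* x′ ℕ.* (C′ ℕ.* y′)) ≡ A ℕ.* A ℕ.* (B′ ℕ.* C′) ℕ.* (w ℕ.* (x′ ℕ.* y′))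
  regroup₂ = solve-∀

Pᵍ Qᵍ : Expr → Expr → Expr
Pᵍ j k = Pʰ j k ⊗ Pʰ j k ⊗ Pʰ j k
Qᵍ j k = (con 3 ⊕ k) ⊗ (con 2 ⊕ k) ⊗ (con 1 ⊕ k)
         ⊗ (con 4 ⊕ con 6 ⊗ j ⊕ k) ⊗ (con 5 ⊕ con 6 ⊗ j ⊕ k) ⊗ (con 6 ⊕ con 6 ⊗ j ⊕ k)

g-as-frac : ∀ l j {a b c m} → l ℕ.+ j ≡ a → l ℕ.+ 3 ℕ.* j ≡ b → l ∸ j ≡ c → 2 ℕ.* j ≡ m →
            g l j ≡ frac (ff a m ℕ.* ff a m) (ff b m ℕ.* ff c m)
g-as-frac l j refl refl refl refl = refl

-- The factors of g at l = 3 (j + 1) + k, with m = 2 j: l + j = m + y, l + 3 j = m + z and l ∸ j = y.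
module GRatio (j k : ℕ) where

  m y z : ℕ
  m = 2 ℕ.* j
  y = 3 ℕ.+ 2 ℕ.* j ℕ.+ k
  z = 3 ℕ.+ 4 ℕ.* j ℕ.+ k

  A B C A′ B′ C′ : ℕ
  A  = ff (m ℕ.+ y) m
  B  = ff (m ℕ.+ z) m
  C  = ff y m
  A′ = ff (suc (m ℕ.+ y)) (2 ℕ.+ m)
  B′ = ff (3 ℕ.+ (m ℕ.+ z)) (2 ℕ.+ m)
  C′ = ff (2 ℕ.+ m ℕ.+ k) (2 ℕ.+ m)

  g₀≡ : g (3 ℕ.* suc j ℕ.+ k) j ≡ frac (A ℕ.* A) (B ℕ.* C)
  g₀≡ = g-as-frac (3 ℕ.* suc j ℕ.+ k) j (a₀ j k) (b₀ j k) (m+n≡o⇒o∸m≡n j y (c₀ j k)) refl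
    where
    a₀ : ∀ j k → 3 ℕ.* suc j ℕ.+ k ℕ.+ j ≡ 2 ℕ.* j ℕ.+ (3 ℕ.+ 2 ℕ.* j ℕ.+ k)
    a₀ = solve-∀
    b₀ : ∀ j k → 3 ℕ.* suc j ℕ.+ k ℕ.+ 3 ℕ.* j ≡ 2 ℕ.* j ℕ.+ (3 ℕ.+ 4 ℕ.* j ℕ.+ k)
    b₀ = solve-∀
    c₀ : ∀ j k → j ℕ.+ (3 ℕ.+ 2 ℕ.* j ℕ.+ k) ≡ 3 ℕ.* suc j ℕ.+ k
    c₀ = solve-∀

  g₁≡ : g (3 ℕ.* suc j ℕ.+ k) (suc j) ≡ frac (A′ ℕ.* A′) (B′ ℕ.* C′)
  g₁≡ = g-as-frac (3 ℕ.* suc j ℕ.+ k) (suc j) (a₁ j k) (b₁ j k)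
          (m+n≡o⇒o∸m≡n (suc j) (2 ℕ.+ m ℕ.+ k) (c₁ j k)) (m₁ j)
    where
    a₁ : ∀ j k → 3 ℕ.* suc j ℕ.+ k ℕ.+ suc j ≡ suc (2 ℕ.* j ℕ.+ (3 ℕ.+ 2 ℕ.* j ℕ.+ k))
    a₁ = solve-∀
    b₁ : ∀ j k → 3 ℕ.* suc j ℕ.+ k ℕ.+ 3 ℕ.* suc j ≡ 3 ℕ.+ (2 ℕ.* j ℕ.+ (3 ℕ.+ 4 ℕ.* j ℕ.+ k))
    b₁ = solve-∀
    c₁ : ∀ j k → suc j ℕ.+ (2 ℕ.+ 2 ℕ.* j ℕ.+ k) ≡ 3 ℕ.* suc j ℕ.+ k
    c₁ = solve-∀
    m₁ : ∀ j → 2 ℕ.* suc j ≡ 2 ℕ.+ 2 ℕ.* j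
    m₁ = solve-∀

  0<BC : 0 < B ℕ.* C
  0<BC = *-posᴺ (ff-pos (ℕ.m≤m+n m z)) (ff-pos (ℕ.≤-trans (ℕ.m≤n+m m 3) (ℕ.m≤m+n (3 ℕ.+ m) k)))

  0<B′C′ : 0 < B′ ℕ.* C′
  0<B′C′ = *-posᴺ (ff-pos (ℕ.+-monoʳ-≤ 2 (ℕ.m≤n⇒m≤1+n (ℕ.m≤m+n m z)))) (ff-pos (ℕ.m≤m+n (2 ℕ.+ m) k))

  cross : A′ ℕ.* A′ ℕ.* (B ℕ.* C) ℕ.* ⟪ Qᵍ ⟫ j k ≡ A ℕ.* A ℕ.* (B′ ℕ.* C′) ℕ.* ⟪ Pᵍ ⟫ j k
  cross = begin
    A′ ℕ.* A′ ℕ.* (B ℕ.* C) ℕ.* ⟪ Qᵍ ⟫ j k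
      ≡⟨ cong (A′ ℕ.* A′ ℕ.* (B ℕ.* C) ℕ.*_) (denominator j k) ⟨
    A′ ℕ.* A′ ℕ.* (B ℕ.* C) ℕ.* (ff (3 ℕ.+ k) 3 ℕ.* ff (3 ℕ.+ (m ℕ.+ z)) 3)
      ≡⟨ g-ratio-cross A B C A′ B′ C′ (suc (m ℕ.+ y)) y (suc z) y (ff (3 ℕ.+ (m ℕ.+ z)) 3) (ff (3 ℕ.+ k) 3)
           (ff-l+j-step m y) (ff-l+3j-step m z) (ff-l∸j-step m k) ⟩
    A ℕ.* A ℕ.* (B′ ℕ.* C′) ℕ.* (suc (m ℕ.+ y) ℕ.* y ℕ.* (suc (m ℕ.+ y) ℕ.* y) ℕ.* (suc z ℕ.* y))
      ≡⟨ cong (A ℕ.* A ℕ.* (B′ ℕ.* C′) ℕ.*_) (numerator j k) ⟩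
    A ℕ.* A ℕ.* (B′ ℕ.* C′) ℕ.* ⟪ Pᵍ ⟫ j k
      ∎
    where
    denominator : ∀ j k → let w = 2 ℕ.* j ℕ.+ (3 ℕ.+ 4 ℕ.* j ℕ.+ k) in
      1 ℕ.* (3 ℕ.+ k) ℕ.* (2 ℕ.+ k) ℕ.* (1 ℕ.+ k) ℕ.* (1 ℕ.* (3 ℕ.+ w) ℕ.* (2 ℕ.+ w) ℕ.* (1 ℕ.+ w))
        ≡ (3 ℕ.+ k) ℕ.* (2 ℕ.+ k) ℕ.* (1 ℕ.+ k)
          ℕ.* (4 ℕ.+ 6 ℕ.* j ℕ.+ k) ℕ.* (5 ℕ.+ 6 ℕ.* j ℕ.+ k) ℕ.* (6 ℕ.+ 6 ℕ.* j ℕ.+ k)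
    denominator = solve-∀
    numerator : ∀ j k → let y = 3 ℕ.+ 2 ℕ.* j ℕ.+ k; x = suc (2 ℕ.* j ℕ.+ y); u = (4 ℕ.+ 4 ℕ.* j ℕ.+ k) ℕ.* y in
      x ℕ.* y ℕ.* (x ℕ.* y) ℕ.* (suc (3 ℕ.+ 4 ℕ.* j ℕ.+ k) ℕ.* y) ≡ u ℕ.* u ℕ.* u
    numerator = solve-∀

g-step : ∀ {l} j k → 3 ℕ.* suc j ℕ.+ k ≡ l → g l (suc j) * ι (⟪ Qᵍ ⟫ j k) ≡ g l j * ι (⟪ Pᵍ ⟫ j k)
g-step j k refl = subst₂ (λ u v → u * ι (⟪ Qᵍ ⟫ j k) ≡ v * ι (⟪ Pᵍ ⟫ j k)) (sym g₁≡) (sym g₀≡)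
  (ratio-by-cross (frac (A ℕ.* A) (B ℕ.* C)) (frac (A′ ℕ.* A′) (B′ ℕ.* C′))
    (A ℕ.* A) (B ℕ.* C) (A′ ℕ.* A′) (B′ ℕ.* C′) (⟪ Pᵍ ⟫ j k) (⟪ Qᵍ ⟫ j k) 0<BC 0<B′C′
    (frac-*-ι (A ℕ.* A) 0<BC) (frac-*-ι (A′ ℕ.* A′) 0<B′C′) cross)
  where open GRatio j k

g-sequence : RatioSequence
g-sequence = record
  { F       = g
  ; P       = ⟪ Pᵍ ⟫
  ; Q       = ⟪ Qᵍ ⟫
  ; F-pos₀  = λ _ → frac-pos {1} {1} (s≤s z≤n) (s≤s z≤n)
  ; step    = g-step
  ; Q-pos   = ≺⇒< (con 0) (Qᵍ X Y) tt
  ; Q<P     = ≺⇒< (Qᵍ X Y) (Pᵍ X Y) tt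
  ; Δ²⁻<Δ²⁺ = ≺⇒< (Numeratorsᴱ.Δ²⁻ Pᵍ Qᵍ X Y) (Numeratorsᴱ.Δ²⁺ Pᵍ Qᵍ X Y) tt
  ; Δ³⁻<Δ³⁺ = ≺⇒< (Numeratorsᴱ.Δ³⁻ Pᵍ Qᵍ X Y) (Numeratorsᴱ.Δ³⁺ Pᵍ Qᵍ X Y) tt
  }

module G = RatioSequenceProperties g-sequence

-- Comparing the two second differences

h-value : ∀ {l} c s → 3 ℕ.* suc (suc c) ℕ.+ s ≡ l → h l c * ι (6 ℕ.+ 2 ℕ.* c ℕ.+ s) ≡ ι (6 ℕ.+ 4 ℕ.* c ℕ.+ s)
h-value c s refl = trans (h-*-ι c (6 ℕ.+ 2 ℕ.* c ℕ.+ s) (split c s) (s≤s z≤n)) (cong ι (sum c s))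
  where
  split : ∀ c s → c ℕ.+ (6 ℕ.+ 2 ℕ.* c ℕ.+ s) ≡ 3 ℕ.* suc (suc c) ℕ.+ s
  split = solve-∀
  sum : ∀ c s → 3 ℕ.* suc (suc c) ℕ.+ s ℕ.+ c ≡ 6 ℕ.+ 4 ℕ.* c ℕ.+ s
  sum = solve-∀

Δ²h<Δ²g : ∀ {l} c s → 3 ℕ.* suc (suc c) ℕ.+ s ≡ l → Δ² (h l) (suc c) ℚ.< Δ² (g l) 1
Δ²h<Δ²g {l} c s eq = <-by-cross {a = Aʰ ℕ.* n} {b = Bʰ ℕ.* n} {c = Aᵍ} {e = Bᵍ} 0<Dʰm 0<Dᵍ Eʰ Eᵍ
  (≺⇒< (Numeratorsᴱ.comparison⁻ Pʰ Qʰ Pᵍ Qᵍ X Y) (Numeratorsᴱ.comparison⁺ Pʰ Qʰ Pᵍ Qᵍ X Y) tt c s)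
  where
  open RatioSequence using (Q-pos)
  Aʰ Bʰ Dʰ Aᵍ Bᵍ Dᵍ m n : ℕ
  Aʰ = Δ²⁺ ⟪ Pʰ ⟫ ⟪ Qʰ ⟫ c s
  Bʰ = Δ²⁻ ⟪ Pʰ ⟫ ⟪ Qʰ ⟫ c s
  Dʰ = Δ²-den ⟪ Pʰ ⟫ ⟪ Qʰ ⟫ c s
  Aᵍ = Δ²⁺ ⟪ Pᵍ ⟫ ⟪ Qᵍ ⟫ 0 (3 ℕ.* c ℕ.+ s)
  Bᵍ = Δ²⁻ ⟪ Pᵍ ⟫ ⟪ Qᵍ ⟫ 0 (3 ℕ.* c ℕ.+ s)
  Dᵍ = Δ²-den ⟪ Pᵍ ⟫ ⟪ Qᵍ ⟫ 0 (3 ℕ.* c ℕ.+ s)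
  m = 6 ℕ.+ 2 ℕ.* c ℕ.+ s
  n = 6 ℕ.+ 4 ℕ.* c ℕ.+ s
  0<Dʰm : 0 < Dʰ ℕ.* m
  0<Dʰm = *-posᴺ {Dʰ} {m} (*-posᴺ (Q-pos h-sequence c (3 ℕ.+ s)) (Q-pos h-sequence (suc c) s)) (s≤s z≤n)
  0<Dᵍ : 0 < Dᵍ
  0<Dᵍ = *-posᴺ (Q-pos g-sequence 0 (3 ℕ.+ (3 ℕ.* c ℕ.+ s))) (Q-pos g-sequence 1 (3 ℕ.* c ℕ.+ s))
  Eʰ : Δ² (h l) (suc c) * ι (Dʰ ℕ.* m) ≡ ι (Aʰ ℕ.* n) - ι (Bʰ ℕ.* n)
  Eʰ = rescale-cross {X = Δ² (h l) (suc c)} {f = h l c} {a = Aʰ} {b = Bʰ} {d = Dʰ} {m = m} {n = n}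
         (H.Δ²-identity c s eq) (h-value c s eq)
  -- g l 0 reduces to 1ℚ.
  Eᵍ : Δ² (g l) 1 * ι Dᵍ ≡ ι Aᵍ - ι Bᵍ
  Eᵍ = trans (G.Δ²-identity 0 (3 ℕ.* c ℕ.+ s) (trans (regroup c s) eq)) (ℚ.*-identityˡ (ι Aᵍ - ι Bᵍ))
    where
    regroup : ∀ c s → 3 ℕ.* 2 ℕ.+ (3 ℕ.* c ℕ.+ s) ≡ 3 ℕ.* suc (suc c) ℕ.+ s
    regroup = solve-∀

τ-decomposition : ∀ l → 3 ℕ.* τ l ℕ.+ l % 3 ≡ l
τ-decomposition l = trans (ℕ.+-comm (3 ℕ.* τ l) (l % 3))
  (trans (cong (l % 3 ℕ.+_) (ℕ.*-comm 3 (τ l))) (sym (m≡m%n+[m/n]*n l 3)))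

Δ²h-last<Δ²g₁ : ∀ l → 6 ≤ l → Δ² (h l) (τ l ∸ 1) ℚ.< Δ² (g l) 1
Δ²h-last<Δ²g₁ l 6≤l with τ l | τ-decomposition l | /-monoˡ-≤ 3 6≤l
... | suc (suc c) | eq | _      = Δ²h<Δ²g c (l % 3) eq
... | 1           | _  | s≤s ()
... | 0           | _  | ()

theorem1p1 : (l : ℕ) → 6 ≤ l →
    ((∀ j → j < τ l → h l j ℚ.< h l (suc j))
     × (∀ j → 1 ≤ j → j ℕ.+ 1 ≤ τ l → ℚ.0ℚ ℚ.< Δ² (h l) j))
    × (∀ j → 1 ≤ j → j ℕ.+ 2 ≤ τ l → ℚ.0ℚ ℚ.< Δ³ (h l) j)
    × ((∀ j → j < τ l → g l j ℚ.< g l (suc j))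
     × (∀ j → 1 ≤ j → j ℕ.+ 1 ≤ τ l → ℚ.0ℚ ℚ.< Δ² (g l) j))
    × (∀ j → 1 ≤ j → j ℕ.+ 2 ≤ τ l → ℚ.0ℚ ℚ.< Δ³ (g l) j)
    × Δ² (h l) (τ l ∸ 1) ℚ.< Δ² (g l) 1
theorem1p1 l 6≤l =
  (H.increasing l , H.Δ²-pos l) , H.Δ³-pos l ,
  (G.increasing l , G.Δ²-pos l) , G.Δ³-pos l ,
  Δ²h-last<Δ²g₁ l 6≤l
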